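{- Fix an integer $k\ge 2$ and a formal variable $q$. For $j\ge 1$ let $\mathbf{A}_{(j)}$ be the $k\times k$ matrix whose $(r,c)$ entry is $q^{(c-1)j}$ if $r+c\le k+1$ and $0$ otherwise, and let $\mathbf{h}^{(j)}=({}_ih^{(j)}_l)_{1\le i,l\le k}=\mathbf{A}_{(1)}\mathbf{A}_{(2)}\cdots\mathbf{A}_{(j)}$. Then for each $j\ge 1$ and $i,l\in\{1,\dots,k\}$, the polynomial ${}_ih^{(j)}_l\in\mathbb{C}[q]$ equals $\sum_{m\ge0}c(m)q^m$, where $c(m)$ is the number of partitions of $m$ that have difference at least 2 at distance $k-1$, in which $1$ appears at most $k-i$ times, whose largest part is at most $j$, and in which $j$ appears exactly $l-1$ times.
   Context: A partition $m=p_1+\cdots+p_n$ with $p_1\ge\cdots\ge p_n>0$ has difference at least 2 at distance $t$ if $p_s-p_{s+t}\ge 2$ whenever $s\ge 1$ and $s+t\le n$. The empty partition of $0$ is included. -}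

module Defs where

open import Data.Nat using (ℕ; zero; suc; _+_; _*_; _∸_; _≤_; _<_; _≟_; _≤?_)
open import Data.Fin using (Fin; toℕ)
import Data.Fin as Fin
open import Data.List using (List; []; _∷_; length)
open import Data.Nat.ListAction using (sum)
open import Data.List.Relation.Unary.All using (All)
open import Data.List.Relation.Unary.Linked using (Linked)
open import Data.List.Relation.Unary.Unique.Propositional using (Unique)
open import Data.List.Membership.Propositional using (_∈_)
open import Data.Product using (Σ; _×_)
open import Function.Bundles using (_⇔_)
open import Relation.Nullary using (yes; no)
open import Relation.Binary.PropositionalEquality using (_≡_)

-- Formal power series / polynomials in q with coefficients in ℕ,
-- represented by their coefficient function  m ↦ [q^m].

Poly : Set
Poly = ℕ → ℕ

qpow : ℕ → Poly
qpow e m with m ≟ e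
... | yes _ = 1
... | no  _ = 0

0P : Poly
0P _ = 0

_⊕_ : Poly → Poly → Poly
(f ⊕ g) m = f m + g m

convAux : Poly → Poly → ℕ → ℕ → ℕ
convAux f g m zero    = f 0 * g m
convAux f g m (suc a) = f (suc a) * g (m ∸ suc a) + convAux f g m a

_⊛_ : Poly → Poly → Poly
(f ⊛ g) m = convAux f g m m

-- k × k matrices of polynomials, indices 0-based via Fin k.

Mat : ℕ → Set
Mat k = Fin k → Fin k → Poly

sumFin : ∀ {n} → (Fin n → Poly) → Poly
sumFin {zero}  f = 0P
sumFin {suc n} f = f Fin.zero ⊕ sumFin (λ x → f (Fin.suc x))

_⊗_ : ∀ {k} → Mat k → Mat k → Mat k
(A ⊗ B) r c = sumFin (λ s → A r s ⊛ B s c)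

-- A_(j): entry (r,c) (1-based) is q^{(c-1) j} if r + c ≤ k + 1, else 0.
-- With 0-based r0 = r-1, c0 = c-1 the condition is r0 + c0 < k.
Amat : (k : ℕ) → ℕ → Mat k
Amat k j r c with suc (toℕ r + toℕ c) ≤? k
... | yes _ = qpow (toℕ c * j)
... | no  _ = 0P

-- hmat k j = A_(1) A_(2) ⋯ A_(j+1)   (i.e. h^(j+1))
hmat : (k : ℕ) → ℕ → Mat k
hmat k zero    = Amat k 1
hmat k (suc j) = hmat k j ⊗ Amat k (suc (suc j))

-- Partitions as lists of parts in nonincreasing order.

_≥_ : ℕ → ℕ → Set
a ≥ b = b ≤ a

IsPartition : ℕ → List ℕ → Set
IsPartition m p = Linked _≥_ p × All (λ x → 1 ≤ x) p × sum p ≡ m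

-- 0-based access with default 0 (only used at valid indices)
at : List ℕ → ℕ → ℕ
at []       _       = 0
at (x ∷ xs) zero    = x
at (x ∷ xs) (suc s) = at xs s

DiffAtDist : ℕ → List ℕ → Set
DiffAtDist t p = ∀ s → s + t < length p → at p (s + t) + 2 ≤ at p s

occ : ℕ → List ℕ → ℕ
occ x [] = 0
occ x (y ∷ ys) with x ≟ y
... | yes _ = suc (occ x ys)
... | no  _ = occ x ys

-- "exactly n objects of type A satisfy P": a duplicate-free list
-- enumerating exactly the objects satisfying P, of length n.
HasCount : {A : Set} → (A → Set) → ℕ → Set
HasCount {A} P n =
  Σ (List A) λ L → Unique L × (∀ x → (x ∈ L) ⇔ P x) × length L ≡ n

-- For j = 1 the only candidate is 1^(l-1), admissible exactly when l - 1 ≤ k - i,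
-- i.e. when entry (i, l) of A_(1) is q^(l-1) rather than 0.  For the step, h^(j+1) = h^(j) A_(j+1)
-- and entry (r, l) of A_(j+1) is q^((l-1)(j+1)) when r + l ≤ k + 1, so the coefficient of q^m in
-- entry (i, l) of h^(j+1) is the sum over such r of the coefficient of q^(m - (l-1)(j+1)) in entry
-- (i, r) of h^(j).  On the partition side, removing the l - 1 parts j + 1 leaves a partition with
-- parts ≤ j, say with r - 1 parts j.  The l + r - 2 largest parts all lie in {j, j + 1}, so the
-- difference condition at distance k - 1 forces l + r - 2 ≤ k - 1; conversely, once this holds,
-- every part j + 1 lies k - 1 places ahead of a part ≤ j - 1, if any.  Parts j + 1 ≥ 2 are not ones, so
-- the row index i is unaffected.

module Submission where

open import Defs
open import Data.Nat using (ℕ; zero; suc; _+_; _*_; _∸_; _≤_; _<_; _≟_; _≤?_; z≤n; s≤s)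
open import Data.Nat.Properties
open import Data.Fin using (Fin; toℕ; fromℕ<)
import Data.Fin as Fin
open import Data.Fin.Properties using (toℕ<n; toℕ-fromℕ<; toℕ-injective)
import Data.Fin.Properties as Finₚ
open import Data.List using (List; []; _∷_; length; map; _++_; replicate)
open import Data.List.Properties using (length-map; length-++; length-replicate; ++-assoc; ++-identityʳ; ++-cancelˡ)
open import Data.Nat.ListAction using (sum)
open import Data.List.Relation.Unary.All as All using (All; []; _∷_)
import Data.List.Relation.Unary.All.Properties as All
open import Data.List.Relation.Unary.Linked as Linked using (Linked; []; [-]; _∷_)
open import Data.List.Relation.Unary.Linked.Properties using (Linked⇒All)
open import Data.List.Relation.Unary.AllPairs using ([]; _∷_)
open import Data.List.Relation.Unary.Any using (here; there)
open import Data.List.Membership.Propositional.Properties using (∈-map⁺; ∈-map⁻; ∈-++⁺ˡ; ∈-++⁺ʳ; ∈-++⁻)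
import Data.List.Relation.Unary.Unique.Propositional.Properties as Unique
open import Data.Product using (∃; _×_; _,_; proj₁; proj₂)
import Data.Sum as Sum
open import Data.Sum using (_⊎_; inj₁; inj₂; [_,_])
open import Data.Empty using (⊥-elim)
open import Function.Base using (_∘_)
open import Function.Bundles using (_⇔_; mk⇔; Equivalence)
open import Function.Definitions using (Injective)
open import Function.Properties.Equivalence using () renaming (trans to ⇔-trans; sym to ⇔-sym)
open import Relation.Nullary using (¬_; Dec; yes; no)
open import Relation.Binary.PropositionalEquality using (_≡_; _≢_; refl; sym; trans; cong; cong₂; subst; module ≡-Reasoning)

open Equivalence using (to; from)

module _ {A : Set} where

  HasCount-resp : {P Q : A → Set} {n : ℕ} → (∀ x → P x ⇔ Q x) → HasCount P n → HasCount Q n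
  HasCount-resp P⇔Q (L , unique , ∈L⇔P , len) = L , unique , (λ x → ⇔-trans (∈L⇔P x) (P⇔Q x)) , len

  HasCount-∅ : {P : A → Set} → (∀ x → ¬ P x) → HasCount P 0
  HasCount-∅ ¬P = [] , [] , (λ x → mk⇔ (λ ()) (⊥-elim ∘ ¬P x)) , refl

  HasCount-≡ : (a : A) → HasCount (_≡ a) 1
  HasCount-≡ a = a ∷ [] , [] ∷ [] , (λ x → mk⇔ (λ { (here x≡a) → x≡a ; (there ()) }) here) , refl

  HasCount-⊎ : {P Q : A → Set} {a b : ℕ} → HasCount P a → HasCount Q b → (∀ x → P x → ¬ Q x) →
               HasCount (λ x → P x ⊎ Q x) (a + b)
  HasCount-⊎ (L , uL , ∈L⇔P , lenL) (M , uM , ∈M⇔Q , lenM) disjoint =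
    L ++ M ,
    Unique.++⁺ uL uM (λ (x∈L , x∈M) → disjoint _ (to (∈L⇔P _) x∈L) (to (∈M⇔Q _) x∈M)) ,
    (λ x → mk⇔ (Sum.map (to (∈L⇔P x)) (to (∈M⇔Q x)) ∘ ∈-++⁻ L)
               [ ∈-++⁺ˡ ∘ from (∈L⇔P x) , ∈-++⁺ʳ L ∘ from (∈M⇔Q x) ]) ,
    trans (length-++ L) (cong₂ _+_ lenL lenM)

  HasCount-Σ : ∀ {n} (f : Fin n → Poly) (m : ℕ) (Q : Fin n → A → Set) →
               (∀ s → HasCount (Q s) (f s m)) → (∀ {s s' x} → Q s x → Q s' x → s ≡ s') →
               HasCount (λ x → ∃ λ s → Q s x) (sumFin f m)
  HasCount-Σ {zero}  _ _ _ _     _          = HasCount-∅ λ { _ (() , _) }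
  HasCount-Σ {suc n} f m Q count functional =
    HasCount-resp (λ x → mk⇔ [ (Fin.zero ,_) , (λ (s , q) → Fin.suc s , q) ]
                             (λ { (Fin.zero , q) → inj₁ q ; (Fin.suc s , q) → inj₂ (s , q) }))
      (HasCount-⊎ (count Fin.zero)
                  (HasCount-Σ (f ∘ Fin.suc) m (Q ∘ Fin.suc) (count ∘ Fin.suc) (λ q q′ → Finₚ.suc-injective (functional q q′)))
                  (λ _ q (_ , q′) → Finₚ.0≢1+n (functional q q′)))

HasCount-image : {A B : Set} {P : A → Set} {n : ℕ} (f : A → B) → Injective _≡_ _≡_ f →
                 HasCount P n → HasCount (λ y → ∃ λ x → P x × y ≡ f x) n
HasCount-image f f-inj (L , unique , ∈L⇔P , len) =
  map f L ,
  Unique.map⁺ f-inj unique ,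
  (λ y → mk⇔ (λ y∈ → let x , x∈L , y≡fx = ∈-map⁻ f y∈ in x , to (∈L⇔P x) x∈L , y≡fx)
             (λ { (x , Px , refl) → ∈-map⁺ f (from (∈L⇔P x) Px) })) ,
  trans (length-map f L) len

qpow-≡ : ∀ e → qpow e e ≡ 1
qpow-≡ e with e ≟ e
... | yes _  = refl
... | no e≢e = ⊥-elim (e≢e refl)

qpow-≢ : ∀ {e x} → x ≢ e → qpow e x ≡ 0
qpow-≢ {e} {x} x≢e with x ≟ e
... | yes x≡e = ⊥-elim (x≢e x≡e)
... | no _    = refl

convAux-vanish : ∀ f g m a → (∀ b → b ≤ a → g (m ∸ b) ≡ 0) → convAux f g m a ≡ 0
convAux-vanish f g m zero    g≡0 rewrite g≡0 0 z≤n = *-zeroʳ (f 0)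
convAux-vanish f g m (suc a) g≡0 rewrite g≡0 (suc a) ≤-refl | *-zeroʳ (f (suc a)) =
  convAux-vanish f g m a (λ b b≤a → g≡0 b (m≤n⇒m≤1+n b≤a))

convAux-single : ∀ f g m a c → c ≤ a → (∀ b → b ≤ a → b ≢ c → g (m ∸ b) ≡ 0) →
                 convAux f g m a ≡ f c * g (m ∸ c)
convAux-single f g m zero    zero    _   _   = refl
convAux-single f g m (suc a) c       c≤a g≡0 with c ≟ suc a
... | yes refl = trans (cong (f c * g (m ∸ c) +_) (convAux-vanish f g m a below)) (+-identityʳ _)
  where
    below : ∀ b → b ≤ a → g (m ∸ b) ≡ 0
    below b b≤a = g≡0 b (m≤n⇒m≤1+n b≤a) (<⇒≢ (s≤s b≤a))
... | no c≢1+a rewrite g≡0 (suc a) ≤-refl (c≢1+a ∘ sym) | *-zeroʳ (f (suc a)) =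
  convAux-single f g m a c (≤-pred (≤∧≢⇒< c≤a c≢1+a)) (λ b b≤a → g≡0 b (m≤n⇒m≤1+n b≤a))

⊛-qpow : ∀ f {e m} → e ≤ m → (f ⊛ qpow e) m ≡ f (m ∸ e)
⊛-qpow f {e} {m} e≤m = begin
  convAux f (qpow e) m m          ≡⟨ convAux-single f (qpow e) m m (m ∸ e) (m∸n≤m m e) off-diagonal ⟩
  f (m ∸ e) * qpow e (m ∸ (m ∸ e)) ≡⟨ cong (λ x → f (m ∸ e) * qpow e x) (m∸[m∸n]≡n e≤m) ⟩
  f (m ∸ e) * qpow e e            ≡⟨ cong (f (m ∸ e) *_) (qpow-≡ e) ⟩
  f (m ∸ e) * 1                   ≡⟨ *-identityʳ _ ⟩
  f (m ∸ e)                       ∎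
  where
    open ≡-Reasoning
    off-diagonal : ∀ b → b ≤ m → b ≢ m ∸ e → qpow e (m ∸ b) ≡ 0
    off-diagonal b b≤m b≢m∸e = qpow-≢ λ m∸b≡e →
      b≢m∸e (∸-cancelˡ-≡ b≤m (m∸n≤m m e) (trans m∸b≡e (sym (m∸[m∸n]≡n e≤m))))

⊛-qpow-> : ∀ f {e m} → m < e → (f ⊛ qpow e) m ≡ 0
⊛-qpow-> f {e} {m} m<e = convAux-vanish f (qpow e) m m
  (λ b _ → qpow-≢ (<⇒≢ (≤-<-trans (m∸n≤m m b) m<e)))

Sorted : List ℕ → Set
Sorted = Linked _≥_

sorted-∷ : ∀ {x ys} → All (_≤ x) ys → Sorted ys → Sorted (x ∷ ys)
sorted-∷ []        _  = [-]
sorted-∷ (y≤x ∷ _) ys = y≤x ∷ ys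

sorted-replicate-++ : ∀ n {x ys} → All (_≤ x) ys → Sorted ys → Sorted (replicate n x ++ ys)
sorted-replicate-++ zero    ys≤x ys = ys
sorted-replicate-++ (suc n) ys≤x ys =
  sorted-∷ (All.++⁺ (All.replicate⁺ n ≤-refl) ys≤x) (sorted-replicate-++ n ys≤x ys)

sorted-++⁻ʳ : ∀ xs {ys} → Sorted (xs ++ ys) → Sorted ys
sorted-++⁻ʳ []       s = s
sorted-++⁻ʳ (_ ∷ xs) s = sorted-++⁻ʳ xs (Linked.tail s)

sorted⇒≤head : ∀ {x xs} → Sorted (x ∷ xs) → All (_≤ x) xs
sorted⇒≤head s = All.tail (Linked⇒All (λ y≤x z≤y → ≤-trans z≤y y≤x) ≤-refl s)

sum-replicate-++ : ∀ n x ys → sum (replicate n x ++ ys) ≡ n * x + sum ys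
sum-replicate-++ zero    x ys = refl
sum-replicate-++ (suc n) x ys = trans (cong (x +_) (sum-replicate-++ n x ys)) (sym (+-assoc x (n * x) (sum ys)))

occ-absent : ∀ {x ys} → All (_≢ x) ys → occ x ys ≡ 0
occ-absent {x} {[]}     []            = refl
occ-absent {x} {y ∷ ys} (y≢x ∷ ys≢x) with x ≟ y
... | yes x≡y = ⊥-elim (y≢x (sym x≡y))
... | no _    = occ-absent ys≢x

occ-replicate-++ : ∀ n {x ys} → All (_≢ x) ys → occ x (replicate n x ++ ys) ≡ n
occ-replicate-++ zero    ys≢x = occ-absent ys≢x
occ-replicate-++ (suc n) {x} ys≢x with x ≟ x
... | yes _  = cong suc (occ-replicate-++ n ys≢x)
... | no x≢x = ⊥-elim (x≢x refl)

occ-replicate-++-other : ∀ n {x y ys} → x ≢ y → occ x (replicate n y ++ ys) ≡ occ x ys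
occ-replicate-++-other zero    x≢y = refl
occ-replicate-++-other (suc n) {x} {y} x≢y with x ≟ y
... | yes x≡y = ⊥-elim (x≢y x≡y)
... | no _    = occ-replicate-++-other n x≢y

sorted-split : ∀ x {p} → Sorted p → All (_≤ x) p →
               ∃ λ p' → p ≡ replicate (occ x p) x ++ p' × All (_< x) p'
sorted-split x {[]}    _ _ = [] , refl , []
sorted-split x {y ∷ p} s (y≤x ∷ p≤x) with x ≟ y
... | yes refl = let p' , p≡ , p'<x = sorted-split x (Linked.tail s) p≤x in p' , cong (x ∷_) p≡ , p'<x
... | no x≢y   = y ∷ p , cong (λ n → replicate n x ++ y ∷ p) (sym (occ-absent (All.map (<⇒≢) p<x))) , y<x ∷ p<x
  where
    y<x : y < x
    y<x = ≤∧≢⇒< y≤x (x≢y ∘ sym)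
    p<x : All (_< x) p
    p<x = All.map (λ z≤y → ≤-<-trans z≤y y<x) (sorted⇒≤head s)

at-≤ : ∀ {b xs} n → All (_≤ b) xs → at xs n ≤ b
at-≤ n       []           = z≤n
at-≤ zero    (x≤b ∷ _)    = x≤b
at-≤ (suc n) (_ ∷ xs≤b)   = at-≤ n xs≤b

at-++-≤ : ∀ xs {ys b} n → All (_≤ b) ys → length xs ≤ n → at (xs ++ ys) n ≤ b
at-++-≤ []       n       ys≤b _           = at-≤ n ys≤b
at-++-≤ (_ ∷ xs) (suc n) ys≤b (s≤s len≤n) = at-++-≤ xs n ys≤b len≤n

at-++-≥ : ∀ {xs} ys {b} n → All (b ≤_) xs → n < length xs → b ≤ at (xs ++ ys) n
at-++-≥ ys zero    (b≤x ∷ _)    _           = b≤x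
at-++-≥ ys (suc n) (_ ∷ b≤xs)   (s≤s n<len) = at-++-≥ ys n b≤xs n<len

DiffAtDist-∷ : ∀ {t x xs} → (t < length (x ∷ xs) → at (x ∷ xs) t + 2 ≤ x) →
               DiffAtDist t xs → DiffAtDist t (x ∷ xs)
DiffAtDist-∷ head D zero    = head
DiffAtDist-∷ head D (suc s) (s≤s s+t<len) = D s s+t<len

DiffAtDist-++⁻ʳ : ∀ {t} xs {ys} → DiffAtDist t (xs ++ ys) → DiffAtDist t ys
DiffAtDist-++⁻ʳ []       D = D
DiffAtDist-++⁻ʳ (_ ∷ xs) D = DiffAtDist-++⁻ʳ xs (λ s s+t<len → D (suc s) (s≤s s+t<len))

DiffAtDist-short : ∀ {t} xs → length xs ≤ t → DiffAtDist t xs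
DiffAtDist-short {t} _ len≤t s s+t<len = ⊥-elim (<⇒≱ (≤-<-trans (m≤n+m t s) s+t<len) len≤t)

-- Two parts differing by at most 1 cannot lie t places apart.
DiffAtDist⇒run-length≤ : ∀ {t lo} xs {ys} → All (lo ≤_) xs → All (_≤ suc lo) xs → DiffAtDist t (xs ++ ys) → length xs ≤ t
DiffAtDist⇒run-length≤             []       _       _       _ = z≤n
DiffAtDist⇒run-length≤ {t} {lo} xs@(x ∷ _) {ys} lo≤xs xs≤1+lo D with length xs ≤? t
... | yes len≤t = len≤t
... | no  len≰t = ⊥-elim (1+n≰n (begin
  2 + lo                  ≡⟨ +-comm 2 lo ⟩
  lo + 2                  ≤⟨ +-monoˡ-≤ 2 (at-++-≥ ys t lo≤xs t<len) ⟩
  at (xs ++ ys) t + 2     ≤⟨ D 0 (<-≤-trans t<len (≤-trans (m≤m+n _ _) (≤-reflexive (sym (length-++ xs))))) ⟩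
  x                       ≤⟨ All.head xs≤1+lo ⟩
  suc lo                  ∎))
  where
    open ≤-Reasoning
    t<len : t < length xs
    t<len = ≰⇒> len≰t

DiffAtDist-replicate-++ : ∀ {t j} l {p} → Sorted p → All (_≤ suc j) p →
  DiffAtDist t (replicate l (suc (suc j)) ++ p) ⇔ (DiffAtDist t p × l + occ (suc j) p ≤ t)
DiffAtDist-replicate-++ {t} {j} l {p} sorted p≤1+j =
  mk⇔ (λ D → DiffAtDist-++⁻ʳ (replicate l J) D , window≤t l D) (λ (D , l+c≤t) → prefix l l+c≤t D)
  where
    J = suc (suc j)
    c = occ (suc j) p
    split = sorted-split (suc j) sorted p≤1+j
    rest = proj₁ split

    top : ℕ → List ℕ
    top n = replicate n J ++ replicate c (suc j)

    length-top : ∀ n → length (top n) ≡ n + c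
    length-top n = trans (length-++ (replicate n J)) (cong₂ _+_ (length-replicate n) (length-replicate c))

    blocks : ∀ n → replicate n J ++ p ≡ top n ++ rest
    blocks n = trans (cong (replicate n J ++_) (proj₁ (proj₂ split))) (sym (++-assoc (replicate n J) _ rest))

    window≤t : ∀ n → DiffAtDist t (replicate n J ++ p) → n + c ≤ t
    window≤t n D = subst (_≤ t) (length-top n)
      (DiffAtDist⇒run-length≤ (top n) (All.++⁺ (All.replicate⁺ n (n≤1+n _)) (All.replicate⁺ c ≤-refl))
                           (All.++⁺ (All.replicate⁺ n ≤-refl) (All.replicate⁺ c (n≤1+n _)))
                           (subst (DiffAtDist t) (blocks n) D))

    prefix : ∀ n → n + c ≤ t → DiffAtDist t p → DiffAtDist t (replicate n J ++ p)
    prefix zero    _         D = D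
    prefix (suc n) 1+n+c≤t D = DiffAtDist-∷ head (prefix n (<⇒≤ 1+n+c≤t) D)
      where
        far : at (replicate (suc n) J ++ p) t ≤ j
        far = subst (λ q → at q t ≤ j) (sym (blocks (suc n)))
                (at-++-≤ (top (suc n)) t (All.map ≤-pred (proj₂ (proj₂ split)))
                         (subst (_≤ t) (sym (length-top (suc n))) 1+n+c≤t))
        head : t < length (replicate (suc n) J ++ p) → at (replicate (suc n) J ++ p) t + 2 ≤ J
        head _ = subst (at (replicate (suc n) J ++ p) t + 2 ≤_) (+-comm j 2) (+-monoˡ-≤ 2 far)

module _ {t : ℕ} (j : ℕ) (r c : Fin (suc t)) where

  Amat-inside : toℕ r + toℕ c ≤ t → ∀ x → Amat (suc t) j r c x ≡ qpow (toℕ c * j) x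
  Amat-inside r+c≤t x with suc (toℕ r + toℕ c) ≤? suc t
  ... | yes _    = refl
  ... | no  r+c≰t = ⊥-elim (r+c≰t (s≤s r+c≤t))

  Amat-outside : ¬ toℕ r + toℕ c ≤ t → ∀ x → Amat (suc t) j r c x ≡ 0
  Amat-outside r+c≰t x with suc (toℕ r + toℕ c) ≤? suc t
  ... | yes r+c≤t = ⊥-elim (r+c≰t (≤-pred r+c≤t))
  ... | no  _     = refl

  ⊛-Amat-inside : ∀ f m → toℕ r + toℕ c ≤ t → (f ⊛ Amat (suc t) j r c) m ≡ (f ⊛ qpow (toℕ c * j)) m
  ⊛-Amat-inside f m r+c≤t = go m
    where
      go : ∀ a → convAux f (Amat (suc t) j r c) m a ≡ convAux f (qpow (toℕ c * j)) m a
      go zero    = cong (f 0 *_) (Amat-inside r+c≤t m)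
      go (suc a) = cong₂ _+_ (cong (f (suc a) *_) (Amat-inside r+c≤t (m ∸ suc a))) (go a)

  ⊛-Amat-outside : ∀ f m → ¬ toℕ r + toℕ c ≤ t → (f ⊛ Amat (suc t) j r c) m ≡ 0
  ⊛-Amat-outside f m r+c≰t = convAux-vanish f _ m m (λ b _ → Amat-outside r+c≰t (m ∸ b))

-- The partitions of m counted by entry (a + 1, b + 1) of h^(j+1) for k = t + 1.
Admissible : (t j a b m : ℕ) → List ℕ → Set
Admissible t j a b m p =
  IsPartition m p × DiffAtDist t p × occ 1 p ≤ t ∸ a × All (_≤ suc j) p × occ (suc j) p ≡ b

positive-<1⇒[] : ∀ {xs} → All (1 ≤_) xs → All (_< 1) xs → xs ≡ []
positive-<1⇒[] []        []        = refl
positive-<1⇒[] (1≤x ∷ _) (x<1 ∷ _) = ⊥-elim (<⇒≱ x<1 1≤x)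

admissible-base⇔ : ∀ {t a b m p} → a ≤ t → Admissible t 0 a b m p ⇔ (a + b ≤ t × m ≡ b × p ≡ replicate b 1)
admissible-base⇔ {t} {a} {b} {m} {p} a≤t = mk⇔ to′ from′
  where
    ones≡ : replicate b 1 ++ [] ≡ replicate b 1
    ones≡ = ++-identityʳ (replicate b 1)

    sum-ones : sum (replicate b 1) ≡ b
    sum-ones = trans (cong sum (sym ones≡)) (trans (sum-replicate-++ b 1 []) (trans (+-identityʳ _) (*-identityʳ b)))

    occ-ones : occ 1 (replicate b 1) ≡ b
    occ-ones = trans (cong (occ 1) (sym ones≡)) (occ-replicate-++ b [])

    to′ : Admissible t 0 a b m p → a + b ≤ t × m ≡ b × p ≡ replicate b 1
    to′ ((sorted , positive , sum≡m) , _ , ones≤ , p≤1 , ones≡b) = a+b≤t , m≡b , p≡1ᵇ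
      where
        split = sorted-split 1 sorted p≤1
        p≡ = proj₁ (proj₂ split)
        rest≡[] : proj₁ split ≡ []
        rest≡[] = positive-<1⇒[] (All.++⁻ʳ (replicate (occ 1 p) 1) (subst (All (1 ≤_)) p≡ positive)) (proj₂ (proj₂ split))
        p≡1ᵇ : p ≡ replicate b 1
        p≡1ᵇ = trans p≡ (trans (cong₂ (λ n q → replicate n 1 ++ q) ones≡b rest≡[]) ones≡)
        m≡b : m ≡ b
        m≡b = trans (sym sum≡m) (trans (cong sum p≡1ᵇ) sum-ones)
        a+b≤t : a + b ≤ t
        a+b≤t = subst (_≤ t) (+-comm b a) (m≤o∸n⇒m+n≤o b a≤t (subst (_≤ t ∸ a) ones≡b ones≤))

    from′ : a + b ≤ t × m ≡ b × p ≡ replicate b 1 → Admissible t 0 a b m p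
    from′ (a+b≤t , refl , refl) =
      (subst Sorted ones≡ (sorted-replicate-++ b [] []) , All.replicate⁺ b ≤-refl , sum-ones) ,
      DiffAtDist-short (replicate b 1) (subst (_≤ t) (sym (length-replicate b)) (m+n≤o⇒n≤o a a+b≤t)) ,
      subst (_≤ t ∸ a) (sym occ-ones) (m+n≤o⇒m≤o∸n b (subst (_≤ t) (+-comm a b) a+b≤t)) ,
      All.replicate⁺ b ≤-refl ,
      occ-ones

Extends : (t j a b m s : ℕ) → List ℕ → Set
Extends t j a b m s p = s + b ≤ t × b * suc (suc j) ≤ m ×
  ∃ λ p' → Admissible t j a s (m ∸ b * suc (suc j)) p' × p ≡ replicate b (suc (suc j)) ++ p'

admissible-suc⇔ : ∀ {t j a b m p} →
  Admissible t (suc j) a b m p ⇔ (∃ λ (s : Fin (suc t)) → Extends t j a b m (toℕ s) p)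
admissible-suc⇔ {t} {j} {a} {b} {m} {p} = mk⇔ to′ from′
  where
    J = suc (suc j)

    ones-unchanged : ∀ p' → occ 1 (replicate b J ++ p') ≡ occ 1 p'
    ones-unchanged p' = occ-replicate-++-other b (λ ())

    to′ : Admissible t (suc j) a b m p → ∃ λ (s : Fin (suc t)) → Extends t j a b m (toℕ s) p
    to′ ((sorted , positive , sum≡m) , D , ones≤ , p≤J , tops≡b) =
      fromℕ< c<1+t , s+b≤t , subst (b * J ≤_) (sym m≡bJ+rest) (m≤m+n _ _) , rest , admissible , p≡
      where
        split = sorted-split J sorted p≤J
        rest = proj₁ split
        p≡ : p ≡ replicate b J ++ rest
        p≡ = trans (proj₁ (proj₂ split)) (cong (λ n → replicate n J ++ rest) tops≡b)
        rest-sorted = sorted-++⁻ʳ (replicate b J) (subst Sorted p≡ sorted)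
        rest≤1+j = All.map ≤-pred (proj₂ (proj₂ split))
        c = occ (suc j) rest
        diff = Equivalence.to (DiffAtDist-replicate-++ b rest-sorted rest≤1+j) (subst (DiffAtDist t) p≡ D)
        c<1+t : c < suc t
        c<1+t = s≤s (m+n≤o⇒n≤o b (proj₂ diff))
        s+b≤t : toℕ (fromℕ< c<1+t) + b ≤ t
        s+b≤t = subst (λ s → s + b ≤ t) (sym (toℕ-fromℕ< c<1+t)) (subst (_≤ t) (+-comm b c) (proj₂ diff))
        m≡bJ+rest : m ≡ b * J + sum rest
        m≡bJ+rest = trans (sym sum≡m) (trans (cong sum p≡) (sum-replicate-++ b J rest))
        admissible : Admissible t j a (toℕ (fromℕ< c<1+t)) (m ∸ b * J) rest
        admissible =
          (rest-sorted , All.++⁻ʳ (replicate b J) (subst (All (1 ≤_)) p≡ positive) ,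
           sym (trans (cong (_∸ b * J) m≡bJ+rest) (m+n∸m≡n (b * J) (sum rest)))) ,
          proj₁ diff ,
          subst (_≤ t ∸ a) (trans (cong (occ 1) p≡) (ones-unchanged rest)) ones≤ ,
          rest≤1+j ,
          sym (toℕ-fromℕ< c<1+t)
    from′ : (∃ λ (s : Fin (suc t)) → Extends t j a b m (toℕ s) p) → Admissible t (suc j) a b m p
    from′ (s , s+b≤t , bJ≤m , rest , ((rest-sorted , positive , sum≡) , D , ones≤ , rest≤1+j , c≡s) , refl) =
      (sorted-replicate-++ b rest≤J rest-sorted ,
       All.++⁺ (All.replicate⁺ b (s≤s z≤n)) positive ,
       trans (sum-replicate-++ b J rest) (trans (cong (b * J +_) sum≡) (m+[n∸m]≡n bJ≤m))) ,
      Equivalence.from (DiffAtDist-replicate-++ b rest-sorted rest≤1+j)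
        (D , subst (λ c → b + c ≤ t) (sym c≡s) (subst (_≤ t) (+-comm (toℕ s) b) s+b≤t)) ,
      subst (_≤ t ∸ a) (sym (ones-unchanged rest)) ones≤ ,
      All.++⁺ (All.replicate⁺ b ≤-refl) rest≤J ,
      occ-replicate-++ b (All.map (λ x≤1+j → <⇒≢ (s≤s x≤1+j)) rest≤1+j)
      where
        rest≤J = All.map m≤n⇒m≤1+n rest≤1+j

count-base : ∀ {t} (i l : Fin (suc t)) m →
  HasCount (Admissible t 0 (toℕ i) (toℕ l) m) (hmat (suc t) 0 i l m)
count-base {t} i l m =
  HasCount-resp (λ _ → ⇔-sym (admissible-base⇔ (≤-pred (toℕ<n i)))) (by-cases (a + b ≤? t) (m ≟ b))
  where
    a = toℕ i
    b = toℕ l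
    by-cases : Dec (a + b ≤ t) → Dec (m ≡ b) →
               HasCount (λ p → a + b ≤ t × m ≡ b × p ≡ replicate b 1) (Amat (suc t) 1 i l m)
    by-cases (no a+b≰t) _ rewrite Amat-outside 1 i l a+b≰t m = HasCount-∅ (λ _ → a+b≰t ∘ proj₁)
    by-cases (yes a+b≤t) (yes refl) rewrite Amat-inside 1 i l a+b≤t b | *-identityʳ b | qpow-≡ b =
      HasCount-resp (λ _ → mk⇔ (λ p≡ → a+b≤t , refl , p≡) (proj₂ ∘ proj₂)) (HasCount-≡ (replicate b 1))
    by-cases (yes a+b≤t) (no m≢b) rewrite Amat-inside 1 i l a+b≤t m | *-identityʳ b | qpow-≢ m≢b =
      HasCount-∅ (λ _ → m≢b ∘ proj₁ ∘ proj₂)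

count-Extends : ∀ {t j} (i l s : Fin (suc t)) m →
  (∀ m′ → HasCount (Admissible t j (toℕ i) (toℕ s) m′) (hmat (suc t) j i s m′)) →
  HasCount (Extends t j (toℕ i) (toℕ l) m (toℕ s)) ((hmat (suc t) j i s ⊛ Amat (suc t) (suc (suc j)) s l) m)
count-Extends {t} {j} i l s m count-j = by-cases (toℕ s + b ≤? t) (b * J ≤? m)
  where
    J = suc (suc j)
    b = toℕ l
    f = hmat (suc t) j i s
    by-cases : Dec (toℕ s + b ≤ t) → Dec (b * J ≤ m) →
               HasCount (Extends t j (toℕ i) b m (toℕ s)) ((f ⊛ Amat (suc t) J s l) m)
    by-cases (no s+b≰t) _ rewrite ⊛-Amat-outside J s l f m s+b≰t = HasCount-∅ (λ _ → s+b≰t ∘ proj₁)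
    by-cases (yes s+b≤t) (no bJ≰m) rewrite ⊛-Amat-inside J s l f m s+b≤t | ⊛-qpow-> f (≰⇒> bJ≰m) =
      HasCount-∅ (λ _ → bJ≰m ∘ proj₁ ∘ proj₂)
    by-cases (yes s+b≤t) (yes bJ≤m) rewrite ⊛-Amat-inside J s l f m s+b≤t | ⊛-qpow f bJ≤m =
      HasCount-resp (λ _ → mk⇔ (λ ext → s+b≤t , bJ≤m , ext) (proj₂ ∘ proj₂))
        (HasCount-image (replicate b J ++_) (++-cancelˡ (replicate b J) _ _) (count-j (m ∸ b * J)))

Extends-functional : ∀ {t j a b m} {s s′ : Fin (suc t)} {p} →
  Extends t j a b m (toℕ s) p → Extends t j a b m (toℕ s′) p → s ≡ s′
Extends-functional {j = j} {b = b} {s = s} {s′}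
  (_ , _ , rest  , (_ , _ , _ , _ , c≡s)  , p≡)
  (_ , _ , rest′ , (_ , _ , _ , _ , c≡s′) , p≡′) = toℕ-injective (begin
    toℕ s             ≡⟨ sym c≡s ⟩
    occ (suc j) rest  ≡⟨ cong (occ (suc j)) (++-cancelˡ (replicate b _) rest rest′ (trans (sym p≡) p≡′)) ⟩
    occ (suc j) rest′ ≡⟨ c≡s′ ⟩
    toℕ s′            ∎)
  where open ≡-Reasoning

count-admissible : ∀ t j (i l : Fin (suc t)) m →
  HasCount (Admissible t j (toℕ i) (toℕ l) m) (hmat (suc t) j i l m)
count-admissible t zero    i l m = count-base i l m
count-admissible t (suc j) i l m =
  HasCount-resp (λ _ → ⇔-sym (admissible-suc⇔ {a = toℕ i}))
    (HasCount-Σ (λ s → hmat (suc t) j i s ⊛ Amat (suc t) (suc (suc j)) s l) m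
                (λ s → Extends t j (toℕ i) (toℕ l) m (toℕ s))
                (λ s → count-Extends i l s m (count-admissible t j i s))
                (Extends-functional {a = toℕ i}))

proposition2p3 : (k : ℕ) → 2 ≤ k → (j' : ℕ) → (i l : Fin k) → (m : ℕ) →
    HasCount (λ p → IsPartition m p × DiffAtDist (k ∸ 1) p × occ 1 p ≤ k ∸ suc (toℕ i)
                    × All (λ x → x ≤ suc j') p × occ (suc j') p ≡ toℕ l)
      (hmat k j' i l m)
proposition2p3 (suc t) _ = count-admissible t
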